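{- Let $\mathbf{C}$ be a locally small category, $\Omega$ an object, $\Phi\colon\mathbf{C}^{\mathrm{op}}\to\mathbf{Pos}$ a functor whose fibres have arbitrary meets preserved by all reindexing maps $f^*:=\Phi f$, $d_\Omega\in\Phi\Omega$, and $\alpha_X,\gamma_X$, $\mathrm{cl}_X=\gamma_X\circ\alpha_X$ as in the context. Let $F\colon\mathbf{C}\to\mathbf{C}$ be a functor with morphisms $(\mathrm{ev}_\lambda\colon F\Omega\to\Omega)_{\lambda\in\Lambda}$ and induced $\Lambda_X$; let $c\colon X\to FX$ be a coalgebra, $\Theta_X\subseteq\mathbf{C}(X,\Omega)$ a set of constants, and $\mathrm{cl}'_X$ a closure on $\mathcal{P}(\mathbf{C}(X,\Omega))$ which is a subclosure of $\mathrm{cl}_X$ ($\mathrm{cl}'_X(S)\subseteq\mathrm{cl}_X(S)$ for all $S$) and compatible ($\Lambda_X(\mathrm{cl}'_X(\mathrm{cl}_X(S)))\subseteq\mathrm{cl}_{FX}(\Lambda_X(\mathrm{cl}'_X(S)))$ for all $S$). Define $\mathrm{lo}_X(S)=\mathcal{P}(c^\bullet)(\Lambda_X(\mathrm{cl}'_X(S)))\cup\Theta_X$, $K_X=\alpha_{FX}\circ\Lambda_X\circ\gamma_X$ and $\mathrm{be}_X(d)=c^*(K_X(d))\wedge\alpha_X(\Theta_X)$ for $d\in\Phi X$. Then $\alpha_X\circ\mathrm{lo}_X\circ\gamma_X=\mathrm{be}_X$.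
   Context: $\alpha_X(S)=\bigwedge_{k\in S}k^*(d_\Omega)$; $\gamma_X(d)=\{k\in\mathbf{C}(X,\Omega)\mid d\preceq k^*(d_\Omega)\}$; $\Lambda_X(S)=\{\mathrm{ev}_\lambda\circ Fh\mid\lambda\in\Lambda,h\in S\}\subseteq\mathbf{C}(FX,\Omega)$. A closure is monotone, idempotent and extensive. $c^\bullet\colon\mathbf{C}(FX,\Omega)\to\mathbf{C}(X,\Omega)$ is $g\mapsto g\circ c$, $\mathcal{P}(c^\bullet)$ its direct image, and $c^*=\Phi c\colon\Phi(FX)\to\Phi X$. -}

module Defs where

open import Level using (Level; _⊔_; suc; Lift; lift)
open import Data.Bool using (Bool; true; false)
open import Data.Product using (Σ; ∃; _×_; _,_)
open import Data.Sum using (_⊎_)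
open import Relation.Binary.PropositionalEquality using (_≡_)
open import Relation.Binary.Bundles using (Poset)
open import Relation.Unary using (Pred; _∈_; _⊆_; _≐_; _∪_)

-- A locally small category: hom-sets are (Agda) sets, equality of
-- morphisms is propositional equality.
record Category (o ℓ : Level) : Set (suc (o ⊔ ℓ)) where
  infixr 9 _∘_
  field
    Obj  : Set o
    Hom  : Obj → Obj → Set ℓ
    id   : ∀ {A} → Hom A A
    _∘_  : ∀ {A B C} → Hom B C → Hom A B → Hom A C
    identityˡ : ∀ {A B} {f : Hom A B} → id ∘ f ≡ f
    identityʳ : ∀ {A B} {f : Hom A B} → f ∘ id ≡ f
    assoc     : ∀ {A B C D} {f : Hom A B} {g : Hom B C} {h : Hom C D} →
                (h ∘ g) ∘ f ≡ h ∘ (g ∘ f)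

record Endofunctor {o ℓ} (C : Category o ℓ) : Set (o ⊔ ℓ) where
  open Category C
  field
    F₀ : Obj → Obj
    F₁ : ∀ {A B} → Hom A B → Hom (F₀ A) (F₀ B)
    F-id : ∀ {A} → F₁ (id {A}) ≡ id
    F-∘  : ∀ {A B C} {f : Hom A B} {g : Hom B C} → F₁ (g ∘ f) ≡ F₁ g ∘ F₁ f

-- A functor Φ : C^op → Pos whose fibres have arbitrary meets (of families
-- indexed by types of level ℓ), preserved by every reindexing map f* = Φ f.
record MeetFibration {o ℓ} (C : Category o ℓ) : Set (suc (o ⊔ ℓ)) where
  open Category C
  field
    fib : Obj → Poset ℓ ℓ ℓ
  Elt : Obj → Set ℓ
  Elt X = Poset.Carrier (fib X)
  field
    reindex   : ∀ {X Y} → Hom X Y → Elt Y → Elt X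
    reindex-mono : ∀ {X Y} (f : Hom X Y) {a b : Elt Y} →
                   Poset._≤_ (fib Y) a b → Poset._≤_ (fib X) (reindex f a) (reindex f b)
    reindex-id : ∀ {X} (a : Elt X) → Poset._≈_ (fib X) (reindex id a) a
    reindex-∘  : ∀ {X Y Z} (f : Hom X Y) (g : Hom Y Z) (a : Elt Z) →
                 Poset._≈_ (fib X) (reindex (g ∘ f) a) (reindex f (reindex g a))
    ⋀ : ∀ {X} {I : Set ℓ} → (I → Elt X) → Elt X
    ⋀-lower    : ∀ {X} {I : Set ℓ} (h : I → Elt X) (i : I) →
                 Poset._≤_ (fib X) (⋀ h) (h i)
    ⋀-greatest : ∀ {X} {I : Set ℓ} (h : I → Elt X) (a : Elt X) →
                 (∀ i → Poset._≤_ (fib X) a (h i)) → Poset._≤_ (fib X) a (⋀ h)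
    reindex-⋀  : ∀ {X Y} (f : Hom X Y) {I : Set ℓ} (h : I → Elt Y) →
                 Poset._≈_ (fib X) (reindex f (⋀ h)) (⋀ (λ i → reindex f (h i)))

record IsClosure {a ℓ : Level} {A : Set a} (cl : Pred A ℓ → Pred A ℓ) : Set (a ⊔ suc ℓ) where
  field
    monotone   : ∀ {S T} → S ⊆ T → cl S ⊆ cl T
    extensive  : ∀ S → S ⊆ cl S
    idempotent : ∀ S → cl (cl S) ≐ cl S

module Construction {o ℓ} (C : Category o ℓ) (Φ : MeetFibration C)
                    (Ω : Category.Obj C) (dΩ : MeetFibration.Elt Φ Ω) where
  open Category C
  open MeetFibration Φ

  Sub : Obj → Set (suc ℓ)
  Sub X = Pred (Hom X Ω) ℓ

  _≤ₓ_ : ∀ {X} → Elt X → Elt X → Set ℓ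
  _≤ₓ_ {X} = Poset._≤_ (fib X)

  _≈ₓ_ : ∀ {X} → Elt X → Elt X → Set ℓ
  _≈ₓ_ {X} = Poset._≈_ (fib X)

  _∧_ : ∀ {X} → Elt X → Elt X → Elt X
  a ∧ b = ⋀ {I = Lift _ Bool} (λ { (lift true) → a ; (lift false) → b })

  α : (X : Obj) → Sub X → Elt X
  α X S = ⋀ {X} {I = Σ (Hom X Ω) (λ k → k ∈ S)} (λ { (k , _) → reindex k dΩ })

  γ : (X : Obj) → Elt X → Sub X
  γ X d k = d ≤ₓ reindex k dΩ

  cl : (X : Obj) → Sub X → Sub X
  cl X S = γ X (α X S)

  module WithFunctor (F : Endofunctor C) (Λ : Set ℓ)
                     (ev : Λ → Hom (Endofunctor.F₀ F Ω) Ω) where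
    open Endofunctor F

    Λ[_] : (X : Obj) → Sub X → Sub (F₀ X)
    Λ[ X ] S g = ∃ λ l → ∃ λ h → h ∈ S × g ≡ ev l ∘ F₁ h

    P[_•] : ∀ {X} → Hom X (F₀ X) → Sub (F₀ X) → Sub X
    P[ c •] S k = ∃ λ g → g ∈ S × k ≡ g ∘ c

    lo : (X : Obj) → Hom X (F₀ X) → Sub X → (Sub X → Sub X) → Sub X → Sub X
    lo X c Θ cl' S = P[ c •] (Λ[ X ] (cl' S)) ∪ Θ

    K : (X : Obj) → Elt X → Elt (F₀ X)
    K X d = α (F₀ X) (Λ[ X ] (γ X d))

    be : (X : Obj) → Hom X (F₀ X) → Sub X → Elt X → Elt X
    be X c Θ d = reindex c (K X d) ∧ α X Θ

-- α turns unions into meets and, because c* preserves meets, turns the direct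
-- image along c^• into reindexing along c. So α_X(lo_X(γ_X d)) is
-- c*(α_{FX}(Λ_X(cl′_X(γ_X d)))) ∧ α_X(Θ_X), and cl′_X fixes γ_X d, being squeezed
-- between the identity and cl_X, which fixes the image of γ_X.
module Submission where

open import Defs
open import Level using (lift)
open import Data.Bool using (true; false)
open import Data.Product using (_,_)
open import Data.Sum using (inj₁; inj₂)
open import Relation.Binary.Bundles using (Poset)
open import Relation.Binary.PropositionalEquality using (refl)
open import Relation.Unary using (_⊆_; _≐_; _∪_)
import Relation.Binary.Reasoning.Setoid as SetoidReasoning

module GaloisConnection {o ℓ} (C : Category o ℓ) (Φ : MeetFibration C)
                        (Ω : Category.Obj C) (dΩ : MeetFibration.Elt Φ Ω) where
  open Category C
  open MeetFibration Φ
  open Construction C Φ Ω dΩ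

  module _ {X : Obj} where
    open Poset (fib X) using (trans; antisym; reflexive)

    ≈⇒≥ : ∀ {a b : Elt X} → a ≈ₓ b → b ≤ₓ a
    ≈⇒≥ a≈b = reflexive (Poset.Eq.sym (fib X) a≈b)

    ∧-lowerˡ : ∀ {a b : Elt X} → (a ∧ b) ≤ₓ a
    ∧-lowerˡ = ⋀-lower _ (lift true)

    ∧-lowerʳ : ∀ {a b : Elt X} → (a ∧ b) ≤ₓ b
    ∧-lowerʳ = ⋀-lower _ (lift false)

    ∧-greatest : ∀ {a b e : Elt X} → e ≤ₓ a → e ≤ₓ b → e ≤ₓ (a ∧ b)
    ∧-greatest e≤a e≤b = ⋀-greatest _ _ λ { (lift true) → e≤a ; (lift false) → e≤b }

    ∧-congˡ : ∀ {a a′ b : Elt X} → a ≈ₓ a′ → (a ∧ b) ≈ₓ (a′ ∧ b)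
    ∧-congˡ a≈a′ = antisym
      (∧-greatest (trans ∧-lowerˡ (reflexive a≈a′)) ∧-lowerʳ)
      (∧-greatest (trans ∧-lowerˡ (≈⇒≥ a≈a′)) ∧-lowerʳ)

    α-antitone : ∀ {S T : Sub X} → S ⊆ T → α X T ≤ₓ α X S
    α-antitone S⊆T = ⋀-greatest _ _ λ { (k , k∈S) → ⋀-lower _ (k , S⊆T k∈S) }

    α-cong : ∀ {S T : Sub X} → S ≐ T → α X S ≈ₓ α X T
    α-cong (S⊆T , T⊆S) = antisym (α-antitone T⊆S) (α-antitone S⊆T)

    α-∪ : ∀ {S T : Sub X} → α X (S ∪ T) ≈ₓ (α X S ∧ α X T)
    α-∪ = antisym
      (∧-greatest (α-antitone inj₁) (α-antitone inj₂))
      (⋀-greatest _ _ λ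
        { (k , inj₁ k∈S) → trans ∧-lowerˡ (⋀-lower _ (k , k∈S))
        ; (k , inj₂ k∈T) → trans ∧-lowerʳ (⋀-lower _ (k , k∈T)) })

    ≤-αγ : ∀ (d : Elt X) → d ≤ₓ α X (γ X d)
    ≤-αγ d = ⋀-greatest _ d λ { (k , d≤k*dΩ) → d≤k*dΩ }

    cl-γ : ∀ (d : Elt X) → cl X (γ X d) ⊆ γ X d
    cl-γ d = trans (≤-αγ d)

    subclosure-fixes-γ : ∀ {cl′ : Sub X → Sub X} →
                         (∀ S → S ⊆ cl′ S) → (∀ S → cl′ S ⊆ cl X S) →
                         ∀ d → cl′ (γ X d) ≐ γ X d
    subclosure-fixes-γ extensive sub d = (λ k∈ → cl-γ d (sub (γ X d) k∈)) , extensive (γ X d)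

  reindex-cong : ∀ {X Y} (f : Hom X Y) {a b : Elt Y} → a ≈ₓ b → reindex f a ≈ₓ reindex f b
  reindex-cong {X} {Y} f a≈b = Poset.antisym (fib X)
    (reindex-mono f (Poset.reflexive (fib Y) a≈b))
    (reindex-mono f (≈⇒≥ a≈b))

  module _ (F : Endofunctor C) (Λ : Set ℓ) (ev : Λ → Hom (Endofunctor.F₀ F Ω) Ω) where
    open Endofunctor F
    open WithFunctor F Λ ev

    Λ-mono : ∀ {X} {S T : Sub X} → S ⊆ T → Λ[ X ] S ⊆ Λ[ X ] T
    Λ-mono S⊆T (l , h , h∈S , eq) = l , h , S⊆T h∈S , eq

    Λ-cong : ∀ {X} {S T : Sub X} → S ≐ T → Λ[ X ] S ≐ Λ[ X ] T
    Λ-cong (S⊆T , T⊆S) = Λ-mono S⊆T , Λ-mono T⊆S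

    α-P• : ∀ {X} (c : Hom X (F₀ X)) (T : Sub (F₀ X)) →
           α X (P[ c •] T) ≈ₓ reindex c (α (F₀ X) T)
    α-P• {X} c T = antisym
      (trans (⋀-greatest _ _ λ { (g , g∈T) →
               trans (⋀-lower _ (g ∘ c , g , g∈T , refl)) (reflexive (reindex-∘ c g dΩ)) })
             (≈⇒≥ (reindex-⋀ c _)))
      (trans (reflexive (reindex-⋀ c _))
             (⋀-greatest _ _ λ { (k , g , g∈T , refl) →
               trans (⋀-lower _ (g , g∈T)) (≈⇒≥ (reindex-∘ c g dΩ)) }))
      where open Poset (fib X) using (trans; antisym; reflexive)

theorem3 : ∀ {o ℓ} (C : Category o ℓ) (Φ : MeetFibration C)
             (Ω : Category.Obj C) (dΩ : MeetFibration.Elt Φ Ω)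
             (F : Endofunctor C) (Λ : Set ℓ)
             (ev : Λ → Category.Hom C (Endofunctor.F₀ F Ω) Ω)
             (X : Category.Obj C) (c : Category.Hom C X (Endofunctor.F₀ F X))
             (Θ : Construction.Sub C Φ Ω dΩ X)
             (cl′ : Construction.Sub C Φ Ω dΩ X → Construction.Sub C Φ Ω dΩ X) →
             IsClosure cl′ →
             (∀ S → cl′ S ⊆ Construction.cl C Φ Ω dΩ X S) →
             (∀ S → Construction.WithFunctor.Λ[_] C Φ Ω dΩ F Λ ev X
                      (cl′ (Construction.cl C Φ Ω dΩ X S))
                    ⊆ Construction.cl C Φ Ω dΩ (Endofunctor.F₀ F X)
                        (Construction.WithFunctor.Λ[_] C Φ Ω dΩ F Λ ev X (cl′ S))) →
             ∀ d → Construction._≈ₓ_ C Φ Ω dΩ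
                     (Construction.α C Φ Ω dΩ X
                       (Construction.WithFunctor.lo C Φ Ω dΩ F Λ ev X c Θ cl′
                         (Construction.γ C Φ Ω dΩ X d)))
                     (Construction.WithFunctor.be C Φ Ω dΩ F Λ ev X c Θ d)
theorem3 C Φ Ω dΩ F Λ ev X c Θ cl′ isClosure sub _ d = begin
  α X (P[ c •] (Λ[ X ] (cl′ (γ X d))) ∪ Θ)        ≈⟨ α-∪ ⟩
  α X (P[ c •] (Λ[ X ] (cl′ (γ X d)))) ∧ α X Θ     ≈⟨ ∧-congˡ (α-P• F Λ ev c _) ⟩
  reindex c (α (F₀ X) (Λ[ X ] (cl′ (γ X d)))) ∧ α X Θ
    ≈⟨ ∧-congˡ (reindex-cong c (α-cong (Λ-cong F Λ ev cl′γ≐γ))) ⟩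
  reindex c (K X d) ∧ α X Θ                        ∎
  where
  open Category C
  open MeetFibration Φ
  open Construction C Φ Ω dΩ
  open WithFunctor F Λ ev
  open Endofunctor F
  open GaloisConnection C Φ Ω dΩ
  open SetoidReasoning (Poset.Eq.setoid (fib X))
  cl′γ≐γ : cl′ (γ X d) ≐ γ X d
  cl′γ≐γ = subclosure-fixes-γ (IsClosure.extensive isClosure) sub d
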